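{- Let $n\ge 1$ and consider the $n$-site open-boundary TASEP with $\alpha=\beta=1$ (rates described in the context). Then its stationary probability is induced by the uniform measure on $\mathcal{T}_n$: $$\mathbb{P}^{\mathrm{st}}_n\{\mathcal{C}\}=\frac{|R^{ -1}\{\mathcal{C}\}|}{|\mathcal{T}_n|}.$$ Equivalently, for every $\mathcal{C}\in\{\bullet,\circ\}^n$, $$|R^{ -1}\{\mathcal{C}\}|\sum_{\mathcal{C}'}W(\mathcal{C}\to\mathcal{C}')=\sum_{\mathcal{C}'}|R^{ -1}\{\mathcal{C}'\}|\,W(\mathcal{C}'\to\mathcal{C}).$$
   Context: Configurations are strings $\mathcal{C}\in\{\bullet,\circ\}^n$. With $\alpha=\beta=1$, the transition rates are: $W(\mathcal{C}\to\mathcal{C}')=1$ if $\mathcal{C}=\circ\mathcal{A}$ and $\mathcal{C}'=\bullet\mathcal{A}$, or $\mathcal{C}=\mathcal{A}\bullet$ and $\mathcal{C}'=\mathcal{A}\circ$, or $\mathcal{C}=\mathcal{A}\bullet\circ\mathcal{A}'$ and $\mathcal{C}'=\mathcal{A}\circ\bullet\mathcal{A}'$; $W(\mathcal{C}\to\mathcal{C}')=0$ otherwise ($\mathcal{A},\mathcal{A}'$ arbitrary, possibly empty, strings over $\{\bullet,\circ\}$). A plane binary tree is a rooted tree in which every vertex is either an endpoint (leaf) or has exactly two children, an ordered left child and right child. $\mathcal{T}_n$ is the set of plane binary trees with $n+2$ endpoints, ordered from left to right. A non-root vertex is a left (resp. right) descendent if it is the left (resp. right) child of its parent. $R:\mathcal{T}_n\to\{\bullet,\circ\}^n$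 sends $T$ to $(t_1,\dots,t_n)$, where $t_k=\bullet$ if the $(k+1)$-th endpoint from the left is a left descendent and $t_k=\circ$ if it is a right descendent. -}

module Defs where

open import Data.Bool using (Bool; true; false; _∧_; _∨_; not; if_then_else_)
open import Data.Nat using (ℕ; zero; suc; _+_)
open import Data.List using (List; []; _∷_; _++_; map; concatMap; length; filter; drop; take)
open import Data.Nat.ListAction using (sum)
open import Data.Vec using (Vec; toList)
import Data.Vec as Vec
open import Relation.Binary.PropositionalEquality using (_≡_)
open import Relation.Nullary.Decidable using (Dec; yes; no)
open import Data.Bool.Properties using () renaming (_≟_ to _≟B_)
open import Data.Nat.Properties using () renaming (_≟_ to _≟ℕ_)
open import Data.List.Properties using (≡-dec)

_≟L_ : (xs ys : List Bool) → Dec (xs ≡ ys)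
_≟L_ = ≡-dec _≟B_

-- Particles: true = ● (occupied), false = ○ (empty).
Config : ℕ → Set
Config n = Vec Bool n

_==_ : Bool → Bool → Bool
true == true = true
false == false = true
_ == _ = false

eqL : List Bool → List Bool → Bool
eqL [] [] = true
eqL (x ∷ xs) (y ∷ ys) = (x == y) ∧ eqL xs ys
eqL _ _ = false

entryB : List Bool → List Bool → Bool
entryB (false ∷ A) (true ∷ A') = eqL A A'
entryB _ _ = false

exitB : List Bool → List Bool → Bool
exitB (x ∷ []) (y ∷ []) = (x == true) ∧ (y == false)
exitB (x ∷ xs) (y ∷ ys) = (x == y) ∧ exitB xs ys
exitB _ _ = false

hopB : List Bool → List Bool → Bool
hopB (true ∷ false ∷ A) (false ∷ true ∷ A') =
  eqL A A' ∨ hopB (false ∷ A) (true ∷ A')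
hopB (x ∷ xs) (y ∷ ys) = (x == y) ∧ hopB xs ys
hopB _ _ = false

W : {n : ℕ} → Config n → Config n → ℕ
W C C' = if entryB (toList C) (toList C') ∨ exitB (toList C) (toList C') ∨ hopB (toList C) (toList C')
         then 1 else 0

allConfigs : (n : ℕ) → List (Config n)
allConfigs zero = Vec.[] ∷ []
allConfigs (suc n) = concatMap (λ b → map (b Vec.∷_) (allConfigs n)) (true ∷ false ∷ [])

data Tree : Set where
  leaf : Tree
  node : Tree → Tree → Tree

leaves : Tree → ℕ
leaves leaf = 1
leaves (node l r) = leaves l + leaves r

treesUpTo : ℕ → List Tree
treesUpTo zero = leaf ∷ []
treesUpTo (suc d) = leaf ∷ concatMap (λ l → map (node l) (treesUpTo d)) (treesUpTo d)

-- 𝒯_n : all plane binary trees with n+2 endpoints, each exactly once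
-- (a tree with n+2 leaves has height ≤ n+1 < n+2).
𝒯 : ℕ → List Tree
𝒯 n = filter (λ T → leaves T ≟ℕ (n + 2)) (treesUpTo (n + 2))

-- Endpoint labels from left to right: true (●) for a left descendent,
-- false (○) for a right descendent; the first argument is the label of the current vertex.
labels : Bool → Tree → List Bool
labels b leaf = b ∷ []
labels b (node l r) = labels true l ++ labels false r

-- R T = (t_1,…,t_n): labels of endpoints 2,…,n+1 (the root label is irrelevant there).
R : (n : ℕ) → Tree → List Bool
R n T = take n (drop 1 (labels false T))

fibre : (n : ℕ) → Config n → ℕ
fibre n C = length (filter (λ T → R n T ≟L toList C) (𝒯 n))

Σc : (n : ℕ) → (Config n → ℕ) → ℕ
Σc n f = sum (map f (allConfigs n))

-- An endpoint word of a tree with at least two endpoints starts with ● and ends with ○, so |R⁻¹{C}| is the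
-- number Z(●C○) of plane binary trees whose endpoint labels read ●C○. Cutting at the root, Z(w) is a sum of
-- Z●(s)·Z○(t) over the factorisations w = st, and by induction every factorisation of u●○v except u● | ○v
-- corresponds to one of u●v or u○v, the exception being the cherry ●○ itself; hence Z(u●○v) = Z(u●v) + Z(u○v),
-- while Z(○v) = Z(u●) = 0 for words of length at least two. So F(C) = Z(●C○) obeys the α = β = 1 matrix-ansatz
-- relations DE = D + E, ⟨W|E = ⟨W|, D|V⟩ = |V⟩, and for such a weight the hop influx F(u●○v) = F(u●v) + F(u○v)
-- telescopes against the hop outflux, the remaining boundary terms being balanced by entry and exit.

module Submission where

open import Data.Bool using (Bool; true; false; _∧_; _∨_; if_then_else_)
open import Data.Bool.Properties using (∨-identityʳ)
open import Data.Empty using (⊥; ⊥-elim)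
open import Data.List using (List; []; _∷_; _++_; [_]; map; concatMap; length; filter; take; drop)
open import Data.List.Properties using (map-++; map-cong; map-∘; ++-assoc; length-++)
open import Data.Nat using (ℕ; zero; suc; _+_; _*_; _≤_; _<_; s≤s; s≤s⁻¹; z≤n)
open import Data.Nat.ListAction using (sum)
open import Data.Nat.ListAction.Properties using (sum-++)
open import Data.Nat.Properties
open import Data.Nat.Tactic.RingSolver using (solve-∀)
open import Data.Product using (Σ-syntax; _×_; _,_; proj₁; proj₂)
open import Data.Sum using (_⊎_; inj₁; inj₂)
open import Data.Vec using (Vec; toList; []; _∷_)
open import Data.Vec.Properties using (length-toList)
open import Function using (_∘_)
open import Relation.Nullary using (Dec; yes; no; does)
open import Relation.Unary using (Pred; Decidable)
open import Relation.Binary.PropositionalEquality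
  using (_≡_; refl; sym; trans; cong; cong₂; subst; subst₂; module ≡-Reasoning)
open import Defs

pattern ● = true
pattern ○ = false

𝟙 : Bool → ℕ
𝟙 b = if b then 1 else 0

𝟙-∧ : ∀ p q → 𝟙 (p ∧ q) ≡ 𝟙 p * 𝟙 q
𝟙-∧ ● q = sym (+-identityʳ (𝟙 q))
𝟙-∧ ○ q = refl

𝟙-∨ : ∀ p q → (p ≡ true → q ≡ true → ⊥) → 𝟙 (p ∨ q) ≡ 𝟙 p + 𝟙 q
𝟙-∨ ● ● disjoint = ⊥-elim (disjoint refl refl)
𝟙-∨ ● ○ _ = refl
𝟙-∨ ○ q _ = refl

∧-true : ∀ {p q} → p ∧ q ≡ true → p ≡ true × q ≡ true
∧-true {●} {●} refl = refl , refl

∨-true : ∀ {p q} → p ∨ q ≡ true → p ≡ true ⊎ q ≡ true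
∨-true {●} refl = inj₁ refl
∨-true {○} refl = inj₂ refl

==-true : ∀ {x y} → (x == y) ≡ true → x ≡ y
==-true {●} {●} refl = refl
==-true {○} {○} refl = refl

eqL-true : ∀ w w' → eqL w w' ≡ true → w ≡ w'
eqL-true [] [] refl = refl
eqL-true (x ∷ w) (y ∷ w') e with ∧-true {x == y} e
... | x≡y , w≡w' = cong₂ _∷_ (==-true x≡y) (eqL-true w w' w≡w')

eqL-refl : ∀ w → eqL w w ≡ true
eqL-refl [] = refl
eqL-refl (● ∷ w) = eqL-refl w
eqL-refl (○ ∷ w) = eqL-refl w

eqL-comm : ∀ w w' → eqL w w' ≡ eqL w' w
eqL-comm [] [] = refl
eqL-comm [] (_ ∷ _) = refl
eqL-comm (_ ∷ _) [] = refl
eqL-comm (● ∷ w) (● ∷ w') = eqL-comm w w'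
eqL-comm (● ∷ w) (○ ∷ w') = refl
eqL-comm (○ ∷ w) (● ∷ w') = refl
eqL-comm (○ ∷ w) (○ ∷ w') = eqL-comm w w'

sum-map-concatMap : ∀ {A B : Set} (h : B → ℕ) (k : A → List B) xs →
  sum (map h (concatMap k xs)) ≡ sum (map (λ x → sum (map h (k x))) xs)
sum-map-concatMap h k [] = refl
sum-map-concatMap h k (x ∷ xs) = begin
  sum (map h (k x ++ concatMap k xs))                ≡⟨ cong sum (map-++ h (k x) _) ⟩
  sum (map h (k x) ++ map h (concatMap k xs))        ≡⟨ sum-++ (map h (k x)) _ ⟩
  sum (map h (k x)) + sum (map h (concatMap k xs))   ≡⟨ cong (sum (map h (k x)) +_) (sum-map-concatMap h k xs) ⟩
  sum (map h (k x)) + sum (map (λ y → sum (map h (k y))) xs) ∎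
  where open ≡-Reasoning

sum-map-+ : ∀ {A : Set} (f g : A → ℕ) xs → sum (map (λ x → f x + g x) xs) ≡ sum (map f xs) + sum (map g xs)
sum-map-+ f g [] = refl
sum-map-+ f g (x ∷ xs) = trans (cong (f x + g x +_) (sum-map-+ f g xs)) (interchange (f x) (g x) _ _)
  where
  interchange : ∀ a b c d → a + b + (c + d) ≡ a + c + (b + d)
  interchange = solve-∀

sum-map-zero : ∀ {A : Set} {h : A → ℕ} xs → (∀ x → h x ≡ 0) → sum (map h xs) ≡ 0
sum-map-zero [] _ = refl
sum-map-zero (x ∷ xs) h≗0 = cong₂ _+_ (h≗0 x) (sum-map-zero xs h≗0)

Σw : ℕ → (List Bool → ℕ) → ℕ
Σw n h = Σc n (h ∘ toList)

Σc-cong : ∀ n {f g : Config n → ℕ} → (∀ C → f C ≡ g C) → Σc n f ≡ Σc n g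
Σc-cong n f≗g = cong sum (map-cong f≗g (allConfigs n))

Σw-cong : ∀ n {f g : List Bool → ℕ} → (∀ w → f w ≡ g w) → Σw n f ≡ Σw n g
Σw-cong n f≗g = Σc-cong n (f≗g ∘ toList)

Σw-suc : ∀ n (h : List Bool → ℕ) → Σw (suc n) h ≡ Σw n (λ w → h (● ∷ w)) + Σw n (λ w → h (○ ∷ w))
Σw-suc n h = begin
  Σw (suc n) h
    ≡⟨ sum-map-concatMap (h ∘ toList) (λ b → map (b ∷_) (allConfigs n)) (● ∷ ○ ∷ []) ⟩
  sum (map (h ∘ toList) (map (● ∷_) A)) + (sum (map (h ∘ toList) (map (○ ∷_) A)) + 0)
    ≡⟨ cong₂ _+_ (cong sum (map-∘ A)) (trans (cong sum (map-∘ A)) (sym (+-identityʳ _))) ⟨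
  Σw n (λ w → h (● ∷ w)) + Σw n (λ w → h (○ ∷ w)) ∎
  where
  open ≡-Reasoning
  A = allConfigs n

Σw-zero : ∀ n {h : List Bool → ℕ} → (∀ w → h w ≡ 0) → Σw n h ≡ 0
Σw-zero n h≗0 = sum-map-zero (allConfigs n) (h≗0 ∘ toList)

Σw-+ : ∀ n (f g : List Bool → ℕ) → Σw n (λ w → f w + g w) ≡ Σw n f + Σw n g
Σw-+ n f g = sum-map-+ (f ∘ toList) (g ∘ toList) (allConfigs n)

Σw-select : ∀ n (F : List Bool → ℕ) (A : Config n) → Σw n (λ w → F w * 𝟙 (eqL w (toList A))) ≡ F (toList A)
Σw-select zero F [] = trans (+-identityʳ _) (*-identityʳ (F []))
Σw-select (suc n) F (● ∷ A) =
  trans (Σw-suc n (λ w → F w * 𝟙 (eqL w (toList (● ∷ A)))))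
    (trans (cong₂ _+_ (Σw-select n (λ w → F (● ∷ w)) A) (Σw-zero n (λ w → *-zeroʳ (F (○ ∷ w)))))
           (+-identityʳ _))
Σw-select (suc n) F (○ ∷ A) =
  trans (Σw-suc n (λ w → F w * 𝟙 (eqL w (toList (○ ∷ A)))))
        (cong₂ _+_ (Σw-zero n (λ w → *-zeroʳ (F (● ∷ w)))) (Σw-select n (λ w → F (○ ∷ w)) A))

Σw-count : ∀ n (A : Config n) → Σw n (λ w → 𝟙 (eqL (toList A) w)) ≡ 1
Σw-count n A = trans (Σw-cong n (λ w → trans (cong 𝟙 (eqL-comm (toList A) w)) (sym (*-identityˡ _))))
                     (Σw-select n (λ _ → 1) A)

particles : List Bool → ℕ
particles [] = 0
particles (x ∷ w) = 𝟙 x + particles w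

entryB-particles : ∀ w w' → entryB w w' ≡ true → particles w' ≡ suc (particles w)
entryB-particles (○ ∷ A) (● ∷ A') e = cong (suc ∘ particles) (sym (eqL-true A A' e))

exitB-particles : ∀ w w' → exitB w w' ≡ true → particles w ≡ suc (particles w')
exitB-particles (x ∷ []) (y ∷ []) e with ∧-true e
... | x≡● , y≡○ rewrite ==-true {x} x≡● | ==-true {y} y≡○ = refl
exitB-particles (x ∷ []) (y ∷ _ ∷ _) e with ∧-true {x == y} e
... | _ , ()
exitB-particles (x ∷ x' ∷ w) (y ∷ w') e with ∧-true {x == y} e
... | x≡y , e' rewrite ==-true x≡y =
  trans (cong (𝟙 y +_) (exitB-particles (x' ∷ w) w' e')) (+-suc (𝟙 y) _)

hopB-particles : ∀ w w' → hopB w w' ≡ true → particles w ≡ particles w'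
hopB-particles (● ∷ ○ ∷ A) (○ ∷ ● ∷ A') e with ∨-true {eqL A A'} e
... | inj₁ A≡A' = cong (suc ∘ particles) (eqL-true A A' A≡A')
hopB-particles (● ∷ ○ ∷ A) (● ∷ w') e = cong suc (hopB-particles (○ ∷ A) w' e)
hopB-particles (● ∷ ● ∷ A) (● ∷ w') e = cong suc (hopB-particles (● ∷ A) w' e)
hopB-particles (● ∷ []) (● ∷ w') e = cong suc (hopB-particles [] w' e)
hopB-particles (○ ∷ w) (○ ∷ w') e = hopB-particles w w' e

-- Entry, exit and hop change the number of particles by +1, −1 and 0, so at most one of them applies.
𝟙-entry∨exit∨hop : ∀ w w' →
  𝟙 (entryB w w' ∨ exitB w w' ∨ hopB w w') ≡ 𝟙 (entryB w w') + (𝟙 (exitB w w') + 𝟙 (hopB w w'))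
𝟙-entry∨exit∨hop w w' =
  trans (𝟙-∨ (entryB w w') _ entry-excludes) (cong (𝟙 (entryB w w') +_) (𝟙-∨ (exitB w w') _ exit-excludes))
  where
  exit-excludes : exitB w w' ≡ true → hopB w w' ≡ true → ⊥
  exit-excludes x h = 1+n≢n (trans (sym (exitB-particles w w' x)) (hopB-particles w w' h))

  entry-excludes : entryB w w' ≡ true → exitB w w' ∨ hopB w w' ≡ true → ⊥
  entry-excludes e xh with ∨-true {exitB w w'} xh
  ... | inj₁ x = <-asym (≤-reflexive (sym (entryB-particles w w' e))) (≤-reflexive (sym (exitB-particles w w' x)))
  ... | inj₂ h = 1+n≢n (trans (sym (entryB-particles w w' e)) (sym (hopB-particles w w' h)))

entryRate : List Bool → ℕ
entryRate (○ ∷ _) = 1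
entryRate _ = 0

exitRate : List Bool → ℕ
exitRate [] = 0
exitRate (x ∷ []) = 𝟙 x
exitRate (_ ∷ y ∷ w) = exitRate (y ∷ w)

hopRate : List Bool → ℕ
hopRate [] = 0
hopRate (● ∷ ○ ∷ w) = suc (hopRate (○ ∷ w))
hopRate (_ ∷ w) = hopRate w

entryInflux : (List Bool → ℕ) → List Bool → ℕ
entryInflux F (● ∷ w) = F (○ ∷ w)
entryInflux F _ = 0

exitInflux : (List Bool → ℕ) → List Bool → ℕ
exitInflux F [] = 0
exitInflux F (x ∷ []) = 𝟙 (x == ○) * F [ ● ]
exitInflux F (x ∷ y ∷ w) = exitInflux (λ s → F (x ∷ s)) (y ∷ w)

hopInflux : (List Bool → ℕ) → List Bool → ℕ
hopInflux F [] = 0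
hopInflux F (○ ∷ ● ∷ w) = F (● ∷ ○ ∷ w) + hopInflux (λ s → F (○ ∷ s)) (● ∷ w)
hopInflux F (x ∷ w) = hopInflux (λ s → F (x ∷ s)) w

exitB-∷ : ∀ x y w z c → exitB (x ∷ w) (y ∷ z ∷ c) ≡ (x == y) ∧ exitB w (z ∷ c)
exitB-∷ x y [] z c = refl
exitB-∷ x y (_ ∷ _) z c = refl

Σw-entryB-out : ∀ n (C : Config n) → Σw n (𝟙 ∘ entryB (toList C)) ≡ entryRate (toList C)
Σw-entryB-out zero [] = refl
Σw-entryB-out (suc n) (● ∷ C) =
  trans (Σw-suc n (𝟙 ∘ entryB (● ∷ toList C))) (cong₂ _+_ (Σw-zero n λ _ → refl) (Σw-zero n λ _ → refl))
Σw-entryB-out (suc n) (○ ∷ C) =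
  trans (Σw-suc n (𝟙 ∘ entryB (○ ∷ toList C))) (cong₂ _+_ (Σw-count n C) (Σw-zero n λ _ → refl))

Σw-exitB-out : ∀ n (C : Config n) → Σw n (𝟙 ∘ exitB (toList C)) ≡ exitRate (toList C)
Σw-exitB-out zero [] = refl
Σw-exitB-out (suc zero) (● ∷ []) = refl
Σw-exitB-out (suc zero) (○ ∷ []) = refl
Σw-exitB-out (suc (suc n)) (● ∷ y ∷ C) =
  trans (Σw-suc (suc n) (𝟙 ∘ exitB (● ∷ y ∷ toList C)))
        (trans (cong₂ _+_ (Σw-exitB-out (suc n) (y ∷ C)) (Σw-zero (suc n) λ _ → refl)) (+-identityʳ _))
Σw-exitB-out (suc (suc n)) (○ ∷ y ∷ C) =
  trans (Σw-suc (suc n) (𝟙 ∘ exitB (○ ∷ y ∷ toList C)))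
        (cong₂ _+_ (Σw-zero (suc n) λ _ → refl) (Σw-exitB-out (suc n) (y ∷ C)))

Σw-hopB-out : ∀ n (C : Config n) → Σw n (𝟙 ∘ hopB (toList C)) ≡ hopRate (toList C)
Σw-hopB-out zero [] = refl
Σw-hopB-out (suc zero) (● ∷ []) = refl
Σw-hopB-out (suc zero) (○ ∷ []) = refl
Σw-hopB-out (suc (suc n)) (○ ∷ y ∷ C) =
  trans (Σw-suc (suc n) (𝟙 ∘ hopB (○ ∷ y ∷ toList C)))
        (cong₂ _+_ (Σw-zero (suc n) λ _ → refl) (Σw-hopB-out (suc n) (y ∷ C)))
Σw-hopB-out (suc (suc n)) (● ∷ ● ∷ C) =
  trans (Σw-suc (suc n) (𝟙 ∘ hopB (● ∷ ● ∷ toList C)))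
        (trans (cong₂ _+_ (Σw-hopB-out (suc n) (● ∷ C)) (Σw-zero (suc n) λ _ → refl)) (+-identityʳ _))
Σw-hopB-out (suc (suc n)) (● ∷ ○ ∷ C) =
  trans (Σw-suc (suc n) (𝟙 ∘ hopB (● ∷ ○ ∷ toList C)))
        (trans (cong₂ _+_ (Σw-hopB-out (suc n) (○ ∷ C)) hop-here) (+-comm _ 1))
  where
  hop-here : Σw (suc n) (λ w → 𝟙 (hopB (● ∷ ○ ∷ toList C) (○ ∷ w))) ≡ 1
  hop-here = trans (Σw-suc n (λ w → 𝟙 (hopB (● ∷ ○ ∷ toList C) (○ ∷ w))))
    (cong₂ _+_ (trans (Σw-cong n λ w → cong 𝟙 (∨-identityʳ (eqL (toList C) w))) (Σw-count n C))
               (Σw-zero n λ _ → refl))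

hopB-●∷ : ∀ w c → hopB (● ∷ w) (● ∷ c) ≡ hopB w c
hopB-●∷ [] c = refl
hopB-●∷ (● ∷ w) c = refl
hopB-●∷ (○ ∷ w) c = refl

Σw-entryB-in : ∀ n F (C : Config n) → Σw n (λ w → F w * 𝟙 (entryB w (toList C))) ≡ entryInflux F (toList C)
Σw-entryB-in zero F [] = trans (+-identityʳ _) (*-zeroʳ (F []))
Σw-entryB-in (suc n) F (● ∷ C) =
  trans (Σw-suc n (λ w → F w * 𝟙 (entryB w (● ∷ toList C))))
        (cong₂ _+_ (Σw-zero n λ w → *-zeroʳ (F (● ∷ w))) (Σw-select n (λ w → F (○ ∷ w)) C))
Σw-entryB-in (suc n) F (○ ∷ C) =
  trans (Σw-suc n (λ w → F w * 𝟙 (entryB w (○ ∷ toList C))))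
        (cong₂ _+_ (Σw-zero n λ w → *-zeroʳ (F (● ∷ w))) (Σw-zero n λ w → *-zeroʳ (F (○ ∷ w))))

Σw-exitB-in : ∀ n F (C : Config n) → Σw n (λ w → F w * 𝟙 (exitB w (toList C))) ≡ exitInflux F (toList C)
Σw-exitB-in zero F [] = trans (+-identityʳ _) (*-zeroʳ (F []))
Σw-exitB-in (suc zero) F (● ∷ []) = cong₂ _+_ (*-zeroʳ (F [ ● ])) (cong (_+ 0) (*-zeroʳ (F [ ○ ])))
Σw-exitB-in (suc zero) F (○ ∷ []) = cong₂ _+_ (*-identityʳ (F [ ● ])) (cong (_+ 0) (*-zeroʳ (F [ ○ ])))
Σw-exitB-in (suc (suc n)) F (● ∷ z ∷ C) =
  trans (Σw-suc (suc n) (λ w → F w * 𝟙 (exitB w (● ∷ z ∷ toList C))))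
        (trans (cong₂ _+_ (trans (Σw-cong (suc n) λ w → cong (λ b → F (● ∷ w) * 𝟙 b) (exitB-∷ ● ● w z (toList C)))
                                 (Σw-exitB-in (suc n) (λ w → F (● ∷ w)) (z ∷ C)))
                          (Σw-zero (suc n) λ w → trans (cong (λ b → F (○ ∷ w) * 𝟙 b) (exitB-∷ ○ ● w z (toList C)))
                                                        (*-zeroʳ (F (○ ∷ w)))))
               (+-identityʳ _))
Σw-exitB-in (suc (suc n)) F (○ ∷ z ∷ C) =
  trans (Σw-suc (suc n) (λ w → F w * 𝟙 (exitB w (○ ∷ z ∷ toList C))))
        (cong₂ _+_ (Σw-zero (suc n) λ w → trans (cong (λ b → F (● ∷ w) * 𝟙 b) (exitB-∷ ● ○ w z (toList C)))
                                                 (*-zeroʳ (F (● ∷ w))))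
                   (trans (Σw-cong (suc n) λ w → cong (λ b → F (○ ∷ w) * 𝟙 b) (exitB-∷ ○ ○ w z (toList C)))
                          (Σw-exitB-in (suc n) (λ w → F (○ ∷ w)) (z ∷ C))))

Σw-hopB-in : ∀ n F (C : Config n) → Σw n (λ w → F w * 𝟙 (hopB w (toList C))) ≡ hopInflux F (toList C)
Σw-hopB-in zero F [] = trans (+-identityʳ _) (*-zeroʳ (F []))
Σw-hopB-in (suc n) F (● ∷ C) =
  trans (Σw-suc n (λ w → F w * 𝟙 (hopB w (● ∷ toList C))))
        (trans (cong₂ _+_ (trans (Σw-cong n λ w → cong (λ b → F (● ∷ w) * 𝟙 b) (hopB-●∷ w (toList C)))
                                 (Σw-hopB-in n (λ w → F (● ∷ w)) C))
                          (Σw-zero n λ w → *-zeroʳ (F (○ ∷ w))))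
               (+-identityʳ _))
Σw-hopB-in (suc zero) F (○ ∷ []) = cong₂ _+_ (*-zeroʳ (F [ ● ])) (cong (_+ 0) (*-zeroʳ (F [ ○ ])))
Σw-hopB-in (suc (suc n)) F (○ ∷ ● ∷ C) =
  trans (Σw-suc (suc n) (λ w → F w * 𝟙 (hopB w (○ ∷ ● ∷ toList C))))
        (cong₂ _+_ hop-into-first-bond (Σw-hopB-in (suc n) (λ w → F (○ ∷ w)) (● ∷ C)))
  where
  hop-into-first-bond : Σw (suc n) (λ w → F (● ∷ w) * 𝟙 (hopB (● ∷ w) (○ ∷ ● ∷ toList C))) ≡ F (● ∷ ○ ∷ toList C)
  hop-into-first-bond =
    trans (Σw-suc n (λ w → F (● ∷ w) * 𝟙 (hopB (● ∷ w) (○ ∷ ● ∷ toList C))))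
          (cong₂ _+_ (Σw-zero n λ w → *-zeroʳ (F (● ∷ ● ∷ w)))
                     (trans (Σw-cong n λ w → cong (λ b → F (● ∷ ○ ∷ w) * 𝟙 b) (∨-identityʳ (eqL w (toList C))))
                            (Σw-select n (λ w → F (● ∷ ○ ∷ w)) C)))
Σw-hopB-in (suc (suc n)) F (○ ∷ ○ ∷ C) =
  trans (Σw-suc (suc n) (λ w → F w * 𝟙 (hopB w (○ ∷ ○ ∷ toList C))))
        (cong₂ _+_ (Σw-zero (suc n) no-hop) (Σw-hopB-in (suc n) (λ w → F (○ ∷ w)) (○ ∷ C)))
  where
  no-hop : ∀ w → F (● ∷ w) * 𝟙 (hopB (● ∷ w) (○ ∷ ○ ∷ toList C)) ≡ 0
  no-hop [] = *-zeroʳ (F [ ● ])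
  no-hop (● ∷ w) = *-zeroʳ (F (● ∷ ● ∷ w))
  no-hop (○ ∷ w) = *-zeroʳ (F (● ∷ ○ ∷ w))

Σc-W-outgoing : ∀ n (C : Config n) → let c = toList C in
  Σc n (λ C' → W C C') ≡ entryRate c + (exitRate c + hopRate c)
Σc-W-outgoing n C = begin
  Σw n (λ w → 𝟙 (entryB c w ∨ exitB c w ∨ hopB c w))
    ≡⟨ Σw-cong n (𝟙-entry∨exit∨hop c) ⟩
  Σw n (λ w → 𝟙 (entryB c w) + (𝟙 (exitB c w) + 𝟙 (hopB c w)))
    ≡⟨ trans (Σw-+ n (𝟙 ∘ entryB c) (λ w → 𝟙 (exitB c w) + 𝟙 (hopB c w)))
             (cong (Σw n (𝟙 ∘ entryB c) +_) (Σw-+ n (𝟙 ∘ exitB c) (𝟙 ∘ hopB c))) ⟩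
  Σw n (𝟙 ∘ entryB c) + (Σw n (𝟙 ∘ exitB c) + Σw n (𝟙 ∘ hopB c))
    ≡⟨ cong₂ _+_ (Σw-entryB-out n C) (cong₂ _+_ (Σw-exitB-out n C) (Σw-hopB-out n C)) ⟩
  entryRate c + (exitRate c + hopRate c) ∎
  where
  open ≡-Reasoning
  c = toList C

Σc-W-incoming : ∀ n (F : List Bool → ℕ) (C : Config n) → let c = toList C in
  Σc n (λ C' → F (toList C') * W C' C) ≡ entryInflux F c + (exitInflux F c + hopInflux F c)
Σc-W-incoming n F C = begin
  Σw n (λ w → F w * 𝟙 (entryB w c ∨ exitB w c ∨ hopB w c))
    ≡⟨ Σw-cong n (λ w → trans (cong (F w *_) (𝟙-entry∨exit∨hop w c))
                               (distrib (F w) (𝟙 (entryB w c)) (𝟙 (exitB w c)) (𝟙 (hopB w c)))) ⟩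
  Σw n (λ w → e w + (x w + h w))
    ≡⟨ trans (Σw-+ n e (λ w → x w + h w)) (cong (Σw n e +_) (Σw-+ n x h)) ⟩
  Σw n e + (Σw n x + Σw n h)
    ≡⟨ cong₂ _+_ (Σw-entryB-in n F C) (cong₂ _+_ (Σw-exitB-in n F C) (Σw-hopB-in n F C)) ⟩
  entryInflux F c + (exitInflux F c + hopInflux F c) ∎
  where
  open ≡-Reasoning
  c = toList C
  e x h : List Bool → ℕ
  e w = F w * 𝟙 (entryB w c)
  x w = F w * 𝟙 (exitB w c)
  h w = F w * 𝟙 (hopB w c)
  distrib : ∀ a p q r → a * (p + (q + r)) ≡ a * p + (a * q + a * r)
  distrib = solve-∀

-- Stationarity of weights obeying the matrix-ansatz relations

-- Reading F w as ⟨W| X_{w₁} ⋯ X_{wₖ} |V⟩ with X_● = D and X_○ = E, these are DE = D + E and D|V⟩ = |V⟩,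
-- imposed on words shorter than N; ⟨W|E = ⟨W| enters stationary as the hypothesis F (○ ∷ r) ≡ F r.
BulkRelation : ℕ → (List Bool → ℕ) → Set
BulkRelation N F = ∀ u v → length (u ++ ● ∷ ○ ∷ v) < N → F (u ++ ● ∷ ○ ∷ v) ≡ F (u ++ ● ∷ v) + F (u ++ ○ ∷ v)

RightRelation : ℕ → (List Bool → ℕ) → Set
RightRelation N F = ∀ u → length (u ++ [ ● ]) < N → F (u ++ [ ● ]) ≡ F u

BulkRelation-∷ : ∀ {N} F x → BulkRelation (suc N) F → BulkRelation N (λ w → F (x ∷ w))
BulkRelation-∷ F x bulk u v lt = bulk (x ∷ u) v (s≤s lt)

BulkRelation-mono : ∀ {M N} F → M ≤ N → BulkRelation N F → BulkRelation M F
BulkRelation-mono F M≤N bulk u v lt = bulk u v (<-≤-trans lt M≤N)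

RightRelation-∷ : ∀ {N} F x → RightRelation (suc N) F → RightRelation N (λ w → F (x ∷ w))
RightRelation-∷ F x right u lt = right (x ∷ u) (s≤s lt)

deleteFirst : Bool → (List Bool → ℕ) → List Bool → ℕ
deleteFirst b F [] = 0
deleteFirst b F (x ∷ w) = 𝟙 (x == b) * F w

deleteLast : Bool → (List Bool → ℕ) → List Bool → ℕ
deleteLast b F [] = 0
deleteLast b F (x ∷ []) = 𝟙 (x == b) * F []
deleteLast b F (x ∷ y ∷ w) = deleteLast b (λ s → F (x ∷ s)) (y ∷ w)

-- By the bulk relation the influx F(u●○v) into a bond ○● is F(u●v) + F(u○v); along the word these terms
-- telescope against the outflux F(w)·hopRate(w), leaving only the boundary terms deleteFirst and deleteLast.
hop-balance : ∀ N F x r → let w = x ∷ r in length w < N → BulkRelation N F →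
  hopInflux F w + deleteFirst ● F w + deleteLast ○ F w ≡ F w * hopRate w + deleteFirst ○ F w + deleteLast ● F w
hop-balance N F ● [] _ _ = single-site (F [ ● ]) (F [])
  where
  single-site : ∀ a b → 0 + (b + 0) + 0 ≡ a * 0 + 0 + (b + 0)
  single-site = solve-∀
hop-balance N F ○ [] _ _ = single-site (F [ ○ ]) (F [])
  where
  single-site : ∀ a b → 0 + 0 + (b + 0) ≡ a * 0 + (b + 0) + 0
  single-site = solve-∀
hop-balance (suc N) F ○ (● ∷ r) (s≤s lt) bulk = begin
  F (● ∷ ○ ∷ r) + h + 0 + p            ≡⟨ cong (λ X → X + h + 0 + p) (bulk [] r (s≤s lt)) ⟩
  F (● ∷ r) + F (○ ∷ r) + h + 0 + p    ≡⟨ regroup (F (● ∷ r)) (F (○ ∷ r)) h p ⟩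
  F (● ∷ r) + (h + (F (○ ∷ r) + 0) + p) ≡⟨ cong (F (● ∷ r) +_) ih ⟩
  F (● ∷ r) + (k + 0 + q)               ≡⟨ regroup' (F (● ∷ r)) k q ⟩
  k + (F (● ∷ r) + 0) + q               ∎
  where
  open ≡-Reasoning
  F○ = λ s → F (○ ∷ s)
  h = hopInflux F○ (● ∷ r)
  p = deleteLast ○ F○ (● ∷ r)
  k = F (○ ∷ ● ∷ r) * hopRate (● ∷ r)
  q = deleteLast ● F○ (● ∷ r)
  ih : h + (F (○ ∷ r) + 0) + p ≡ k + 0 + q
  ih = hop-balance N F○ ● r lt (BulkRelation-∷ F ○ bulk)
  regroup : ∀ a b h p → a + b + h + 0 + p ≡ a + (h + (b + 0) + p)
  regroup = solve-∀
  regroup' : ∀ a k q → a + (k + 0 + q) ≡ k + (a + 0) + q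
  regroup' = solve-∀
hop-balance (suc N) F ● (○ ∷ r) (s≤s lt) bulk = begin
  h + (F (○ ∷ r) + 0) + p                       ≡⟨ regroup h (F (○ ∷ r)) p ⟩
  h + 0 + p + F (○ ∷ r)                         ≡⟨ cong (_+ F (○ ∷ r)) ih ⟩
  X * c + (F (● ∷ r) + 0) + q + F (○ ∷ r)       ≡⟨ cong (λ Y → Y * c + (F (● ∷ r) + 0) + q + F (○ ∷ r)) bond ⟩
  (F (● ∷ r) + F (○ ∷ r)) * c + (F (● ∷ r) + 0) + q + F (○ ∷ r)
                                                ≡⟨ regroup' (F (● ∷ r)) (F (○ ∷ r)) c q ⟩
  (F (● ∷ r) + F (○ ∷ r)) * suc c + 0 + q       ≡⟨ cong (λ Y → Y * suc c + 0 + q) bond ⟨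
  X * suc c + 0 + q                             ∎
  where
  open ≡-Reasoning
  F● = λ s → F (● ∷ s)
  h = hopInflux F● (○ ∷ r)
  p = deleteLast ○ F● (○ ∷ r)
  q = deleteLast ● F● (○ ∷ r)
  X = F (● ∷ ○ ∷ r)
  c = hopRate (○ ∷ r)
  bond : X ≡ F (● ∷ r) + F (○ ∷ r)
  bond = bulk [] r (s≤s lt)
  ih : h + 0 + p ≡ X * c + (F (● ∷ r) + 0) + q
  ih = hop-balance N F● ○ r lt (BulkRelation-∷ F ● bulk)
  regroup : ∀ h b p → h + (b + 0) + p ≡ h + 0 + p + b
  regroup = solve-∀
  regroup' : ∀ a b c q → (a + b) * c + (a + 0) + q + b ≡ (a + b) * suc c + 0 + q
  regroup' = solve-∀
hop-balance (suc N) F ● (● ∷ r) (s≤s lt) bulk = hop-balance N (λ s → F (● ∷ s)) ● r lt (BulkRelation-∷ F ● bulk)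
hop-balance (suc N) F ○ (○ ∷ r) (s≤s lt) bulk = hop-balance N (λ s → F (○ ∷ s)) ○ r lt (BulkRelation-∷ F ○ bulk)

exit-balance : ∀ N F x r → let w = x ∷ r in length w < N → RightRelation N F →
  exitInflux F w + deleteLast ● F w ≡ F w * exitRate w + deleteLast ○ F w
exit-balance N F ● [] lt right = cong (_+ 0) (trans (sym (right [] lt)) (sym (*-identityʳ (F [ ● ]))))
exit-balance N F ○ [] lt right =
  trans (+-identityʳ _) (trans (cong (_+ 0) (right [] lt)) (sym (cong (_+ (F [] + 0)) (*-zeroʳ (F [ ○ ])))))
exit-balance (suc N) F x (y ∷ r) (s≤s lt) right = exit-balance N (λ s → F (x ∷ s)) y r lt (RightRelation-∷ F x right)

entry-balance : ∀ F x r → let w = x ∷ r in F (○ ∷ r) ≡ F r →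
  entryInflux F w + deleteFirst ○ F w ≡ F w * entryRate w + deleteFirst ● F w
entry-balance F ● r left =
  trans (+-identityʳ _) (trans left (sym (trans (cong (_+ (F r + 0)) (*-zeroʳ (F (● ∷ r)))) (+-identityʳ _))))
entry-balance F ○ r left = cong (_+ 0) (trans (sym left) (sym (*-identityʳ (F (○ ∷ r)))))

stationary : ∀ N F x r → let w = x ∷ r in
  length w < N → BulkRelation N F → RightRelation N F → F (○ ∷ r) ≡ F r →
  F w * (entryRate w + (exitRate w + hopRate w)) ≡ entryInflux F w + (exitInflux F w + hopInflux F w)
stationary N F x r lt bulk right left = +-cancelʳ-≡ boundary _ _ (begin
  F w * (entryRate w + (exitRate w + hopRate w)) + boundary
    ≡⟨ regroup (F w) (entryRate w) (exitRate w) (hopRate w) first○ first● last○ last● ⟩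
  (F w * entryRate w + first●) + (F w * exitRate w + last○) + (F w * hopRate w + first○ + last●)
    ≡⟨ cong₂ _+_ (cong₂ _+_ (entry-balance F x r left) (exit-balance N F x r lt right))
                 (hop-balance N F x r lt bulk) ⟨
  (entryInflux F w + first○) + (exitInflux F w + last●) + (hopInflux F w + first● + last○)
    ≡⟨ regroup' (entryInflux F w) (exitInflux F w) (hopInflux F w) first○ first● last○ last● ⟩
  entryInflux F w + (exitInflux F w + hopInflux F w) + boundary ∎)
  where
  open ≡-Reasoning
  w = x ∷ r
  first○ = deleteFirst ○ F w
  first● = deleteFirst ● F w
  last○ = deleteLast ○ F w
  last● = deleteLast ● F w
  boundary = first○ + first● + last○ + last●
  regroup : ∀ f e x h p₁ p₂ q₁ q₂ →
    f * (e + (x + h)) + (p₁ + p₂ + q₁ + q₂) ≡ (f * e + p₂) + (f * x + q₁) + (f * h + p₁ + q₂)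
  regroup = solve-∀
  regroup' : ∀ e x h p₁ p₂ q₁ q₂ →
    (e + p₁) + (x + q₂) + (h + p₂ + q₁) ≡ e + (x + h) + (p₁ + p₂ + q₁ + q₂)
  regroup' = solve-∀

-- Counting plane binary trees by their endpoint labels

-- splitSum f g w = Σ f s * g t over the factorisations w = s ++ t with s ≠ [].
splitSum : (List Bool → ℕ) → (List Bool → ℕ) → List Bool → ℕ
splitSum f g [] = 0
splitSum f g (x ∷ w) = f [ x ] * g w + splitSum (λ s → f (x ∷ s)) g w

splitSum-cong : ∀ {f f' g g'} w → (∀ s → f s ≡ f' s) → (∀ t → g t ≡ g' t) → splitSum f g w ≡ splitSum f' g' w
splitSum-cong [] _ _ = refl
splitSum-cong (x ∷ w) f≗f' g≗g' = cong₂ _+_ (cong₂ _*_ (f≗f' [ x ]) (g≗g' w)) (splitSum-cong w (f≗f' ∘ (x ∷_)) g≗g')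

splitSum-congˡ-< : ∀ {f f'} g w → g [] ≡ 0 → (∀ s → length s < length w → f s ≡ f' s) →
  splitSum f g w ≡ splitSum f' g w
splitSum-congˡ-< g [] _ _ = refl
splitSum-congˡ-< {f} {f'} g (x ∷ []) g[]≡0 _ = cong (_+ 0) (trans (vanish (f [ x ])) (sym (vanish (f' [ x ]))))
  where
  vanish : ∀ a → a * g [] ≡ 0
  vanish a = trans (cong (a *_) g[]≡0) (*-zeroʳ a)
splitSum-congˡ-< {f} g (x ∷ y ∷ w) g[]≡0 f≗f' =
  cong₂ _+_ (cong (_* g (y ∷ w)) (f≗f' [ x ] (s≤s (s≤s z≤n))))
            (splitSum-congˡ-< g (y ∷ w) g[]≡0 λ s lt → f≗f' (x ∷ s) (s≤s lt))

splitSum-zeroˡ : ∀ {f} g w → (∀ s → f s ≡ 0) → splitSum f g w ≡ 0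
splitSum-zeroˡ g [] _ = refl
splitSum-zeroˡ g (x ∷ w) f≗0 = cong₂ _+_ (cong (_* g w) (f≗0 [ x ])) (splitSum-zeroˡ g w (f≗0 ∘ (x ∷_)))

splitSum-zeroʳ : ∀ f {g} w → (∀ t → g t ≡ 0) → splitSum f g w ≡ 0
splitSum-zeroʳ f [] _ = refl
splitSum-zeroʳ f (x ∷ w) g≗0 =
  cong₂ _+_ (trans (cong (f [ x ] *_) (g≗0 w)) (*-zeroʳ (f [ x ]))) (splitSum-zeroʳ (λ s → f (x ∷ s)) w g≗0)

splitSum-*ˡ : ∀ k f g w → splitSum (λ s → k * f s) g w ≡ k * splitSum f g w
splitSum-*ˡ k f g [] = sym (*-zeroʳ k)
splitSum-*ˡ k f g (x ∷ w) = begin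
  k * f [ x ] * g w + splitSum (λ s → k * f (x ∷ s)) g w
    ≡⟨ cong₂ _+_ (*-assoc k (f [ x ]) (g w)) (splitSum-*ˡ k _ g w) ⟩
  k * (f [ x ] * g w) + k * splitSum (λ s → f (x ∷ s)) g w
    ≡⟨ *-distribˡ-+ k _ _ ⟨
  k * (f [ x ] * g w + splitSum (λ s → f (x ∷ s)) g w) ∎
  where open ≡-Reasoning

splitSum-+ˡ : ∀ f₁ f₂ g w → splitSum (λ s → f₁ s + f₂ s) g w ≡ splitSum f₁ g w + splitSum f₂ g w
splitSum-+ˡ f₁ f₂ g [] = refl
splitSum-+ˡ f₁ f₂ g (x ∷ w) =
  trans (cong ((f₁ [ x ] + f₂ [ x ]) * g w +_) (splitSum-+ˡ (λ s → f₁ (x ∷ s)) (λ s → f₂ (x ∷ s)) g w))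
        (interchange (f₁ [ x ]) (f₂ [ x ]) (g w) _ _)
  where
  interchange : ∀ a b c p q → (a + b) * c + (p + q) ≡ a * c + p + (b * c + q)
  interchange = solve-∀

splitSum-+ʳ : ∀ f g₁ g₂ w → splitSum f (λ t → g₁ t + g₂ t) w ≡ splitSum f g₁ w + splitSum f g₂ w
splitSum-+ʳ f g₁ g₂ [] = refl
splitSum-+ʳ f g₁ g₂ (x ∷ w) =
  trans (cong (f [ x ] * (g₁ w + g₂ w) +_) (splitSum-+ʳ (λ s → f (x ∷ s)) g₁ g₂ w))
        (interchange (f [ x ]) (g₁ w) (g₂ w) _ _)
  where
  interchange : ∀ a b c p q → a * (b + c) + (p + q) ≡ a * b + p + (a * c + q)
  interchange = solve-∀

-- Every factorisation of u●○v except u● | ○v matches one of u●v or u○v.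
splitSum-●○ : ∀ f g u v → let w = u ++ ● ∷ ○ ∷ v in
  g [] ≡ 0 → BulkRelation (length w) f → BulkRelation (length w) g →
  splitSum f g w ≡ splitSum f g (u ++ ● ∷ v) + splitSum f g (u ++ ○ ∷ v) + f (u ++ [ ● ]) * g (○ ∷ v)
splitSum-●○ f g [] [] g[]≡0 _ _
  rewrite g[]≡0 | *-zeroʳ (f [ ● ]) | *-zeroʳ (f [ ○ ]) | *-zeroʳ (f (● ∷ ○ ∷ [])) = +-identityʳ _
splitSum-●○ f g [] v@(_ ∷ _) g[]≡0 bulk-f _ =
  trans (cong (f [ ● ] * g (○ ∷ v) +_) (cong₂ _+_ first-split later-splits))
        (regroup (f [ ● ] * g (○ ∷ v)) (f [ ● ] * g v) (f [ ○ ] * g v) _ _)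
  where
  first-split : f (● ∷ ○ ∷ []) * g v ≡ f [ ● ] * g v + f [ ○ ] * g v
  first-split = trans (cong (_* g v) (bulk-f [] [] (s≤s (s≤s (s≤s z≤n))))) (*-distribʳ-+ (g v) (f [ ● ]) _)
  later-splits : splitSum (λ s → f (● ∷ ○ ∷ s)) g v ≡ splitSum (λ s → f (● ∷ s)) g v + splitSum (λ s → f (○ ∷ s)) g v
  later-splits = trans (splitSum-congˡ-< g v g[]≡0 (λ s lt → bulk-f [] s (s≤s (s≤s lt))))
                       (splitSum-+ˡ (λ s → f (● ∷ s)) (λ s → f (○ ∷ s)) g v)
  regroup : ∀ e p q s t → e + (p + q + (s + t)) ≡ p + s + (q + t) + e
  regroup = solve-∀
splitSum-●○ f g (x ∷ u) v g[]≡0 bulk-f bulk-g =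
  trans (cong₂ _+_ (trans (cong (f [ x ] *_) (bulk-g u v ≤-refl)) (*-distribˡ-+ (f [ x ]) _ _))
                   (splitSum-●○ (λ s → f (x ∷ s)) g u v g[]≡0 (BulkRelation-∷ f x bulk-f)
                                (BulkRelation-mono g (n≤1+n _) bulk-g)))
        (regroup (f [ x ] * g (u ++ ● ∷ v)) (f [ x ] * g (u ++ ○ ∷ v)) _ _ _)
  where
  regroup : ∀ a b p q e → a + b + (p + q + e) ≡ a + p + (b + q) + e
  regroup = solve-∀

splitSum-zero-∷● : ∀ f {g} w → g [] ≡ 0 → (∀ t → g (t ++ [ ● ]) ≡ 0) → splitSum f g (w ++ [ ● ]) ≡ 0
splitSum-zero-∷● f [] g[]≡0 _ = trans (+-identityʳ _) (trans (cong (f [ ● ] *_) g[]≡0) (*-zeroʳ (f [ ● ])))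
splitSum-zero-∷● f (x ∷ w) g[]≡0 g-∷● =
  cong₂ _+_ (trans (cong (f [ x ] *_) (g-∷● w)) (*-zeroʳ (f [ x ]))) (splitSum-zero-∷● (λ s → f (x ∷ s)) w g[]≡0 g-∷●)

leafCount : Bool → List Bool → ℕ
leafCount b [] = 0
leafCount b (x ∷ []) = 𝟙 (x == b)
leafCount b (_ ∷ _ ∷ _) = 0

leafCount-long : ∀ b a u x v → leafCount b (a ∷ u ++ x ∷ v) ≡ 0
leafCount-long b a [] x v = refl
leafCount-long b a (_ ∷ _) x v = refl

-- Trees of height ≤ d with root label b whose endpoint labels read w (see treeCount-labels); the height bound
-- makes the recursion structural and is why treeCount-bulk holds only for words of length ≤ d.
treeCount : ℕ → Bool → List Bool → ℕ
treeCount zero b w = leafCount b w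
treeCount (suc d) b w = leafCount b w + splitSum (treeCount d ●) (treeCount d ○) w

treeCount-[] : ∀ d b → treeCount d b [] ≡ 0
treeCount-[] zero b = refl
treeCount-[] (suc d) b = refl

treeCount-[_] : ∀ x d b → treeCount d b [ x ] ≡ 𝟙 (x == b)
treeCount-[ x ] zero b = refl
treeCount-[ x ] (suc d) b rewrite treeCount-[] d ○ | *-zeroʳ (treeCount d ● [ x ]) = +-identityʳ _

treeCount-○∷ : ∀ d b c v → treeCount d b (○ ∷ c ∷ v) ≡ 0
treeCount-○∷ zero b c v = refl
treeCount-○∷ (suc d) b c v =
  cong₂ _+_ (cong (_* treeCount d ○ (c ∷ v)) (treeCount-[ ○ ] d ●))
            (splitSum-zeroˡ (treeCount d ○) (c ∷ v) starts-with-○)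
  where
  starts-with-○ : ∀ s → treeCount d ● (○ ∷ s) ≡ 0
  starts-with-○ [] = treeCount-[ ○ ] d ●
  starts-with-○ (c' ∷ s) = treeCount-○∷ d ● c' s

treeCount-∷● : ∀ d b a s → treeCount d b (a ∷ s ++ [ ● ]) ≡ 0
treeCount-∷● zero b a s = leafCount-long b a s ● []
treeCount-∷● (suc d) b a s =
  cong₂ _+_ (leafCount-long b a s ● []) (splitSum-zero-∷● (treeCount d ●) (a ∷ s) (treeCount-[] d ○) ends-with-●)
  where
  ends-with-● : ∀ t → treeCount d ○ (t ++ [ ● ]) ≡ 0
  ends-with-● [] = treeCount-[ ● ] d ○
  ends-with-● (a' ∷ t) = treeCount-∷● d ○ a' t

-- The factorisation u● | ○v of u●○v is a cherry of two sibling leaves when u = v = [], and counts no tree otherwise.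
treeCount-cherry : ∀ d b u v →
  treeCount d ● (u ++ [ ● ]) * treeCount d ○ (○ ∷ v) ≡ leafCount b (u ++ ● ∷ v) + leafCount b (u ++ ○ ∷ v)
treeCount-cherry d b [] [] rewrite treeCount-[ ● ] d ● | treeCount-[ ○ ] d ○ = one-leaf b
  where
  one-leaf : ∀ b → 1 ≡ 𝟙 (● == b) + 𝟙 (○ == b)
  one-leaf ● = refl
  one-leaf ○ = refl
treeCount-cherry d b [] (c ∷ v) =
  trans (cong (treeCount d ● [ ● ] *_) (treeCount-○∷ d ○ c v)) (*-zeroʳ (treeCount d ● [ ● ]))
treeCount-cherry d b (a ∷ u) v =
  trans (cong (_* treeCount d ○ (○ ∷ v)) (treeCount-∷● d ● a u))
        (sym (cong₂ _+_ (leafCount-long b a u ● v) (leafCount-long b a u ○ v)))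

treeCount-bulk : ∀ d b → BulkRelation (suc d) (treeCount d b)
treeCount-bulk zero b [] v (s≤s ())
treeCount-bulk zero b (_ ∷ _) v (s≤s ())
treeCount-bulk (suc d) b u v lt = begin
  leafCount b (u ++ ● ∷ ○ ∷ v) + splitSum G● G○ (u ++ ● ∷ ○ ∷ v)
    ≡⟨ cong₂ _+_ (no-leaf u) (splitSum-●○ G● G○ u v (treeCount-[] d ○) (bulk-below ●) (bulk-below ○)) ⟩
  S● + S○ + G● (u ++ [ ● ]) * G○ (○ ∷ v)
    ≡⟨ cong (S● + S○ +_) (treeCount-cherry d b u v) ⟩
  S● + S○ + (leafCount b (u ++ ● ∷ v) + leafCount b (u ++ ○ ∷ v))
    ≡⟨ regroup S● S○ (leafCount b (u ++ ● ∷ v)) (leafCount b (u ++ ○ ∷ v)) ⟩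
  leafCount b (u ++ ● ∷ v) + S● + (leafCount b (u ++ ○ ∷ v) + S○) ∎
  where
  open ≡-Reasoning
  G● G○ : List Bool → ℕ
  G● = treeCount d ●
  G○ = treeCount d ○
  S● = splitSum G● G○ (u ++ ● ∷ v)
  S○ = splitSum G● G○ (u ++ ○ ∷ v)
  no-leaf : ∀ u → leafCount b (u ++ ● ∷ ○ ∷ v) ≡ 0
  no-leaf [] = refl
  no-leaf (a ∷ u) = leafCount-long b a u ● (○ ∷ v)
  bulk-below : ∀ b' → BulkRelation (length (u ++ ● ∷ ○ ∷ v)) (treeCount d b')
  bulk-below b' = BulkRelation-mono (treeCount d b') (s≤s⁻¹ lt) (treeCount-bulk d b')
  regroup : ∀ s t l m → s + t + (l + m) ≡ l + s + (m + t)
  regroup = solve-∀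

𝟙-eqL-[_] : ∀ b w → 𝟙 (eqL [ b ] w) ≡ leafCount b w
𝟙-eqL-[ b ] [] = refl
𝟙-eqL-[ ● ] (● ∷ []) = refl
𝟙-eqL-[ ● ] (○ ∷ []) = refl
𝟙-eqL-[ ○ ] (● ∷ []) = refl
𝟙-eqL-[ ○ ] (○ ∷ []) = refl
𝟙-eqL-[ ● ] (● ∷ _ ∷ _) = refl
𝟙-eqL-[ ● ] (○ ∷ _ ∷ _) = refl
𝟙-eqL-[ ○ ] (● ∷ _ ∷ _) = refl
𝟙-eqL-[ ○ ] (○ ∷ _ ∷ _) = refl

𝟙-eqL-++ : ∀ L R w →
  𝟙 (eqL (L ++ R) w) ≡ 𝟙 (eqL L []) * 𝟙 (eqL R w) + splitSum (λ s → 𝟙 (eqL L s)) (λ t → 𝟙 (eqL R t)) w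
𝟙-eqL-++ [] R [] = sym (trans (+-identityʳ _) (+-identityʳ _))
𝟙-eqL-++ [] R (x ∷ w) =
  sym (trans (cong (𝟙 (eqL R (x ∷ w)) + 0 +_) (splitSum-zeroˡ (λ t → 𝟙 (eqL R t)) w λ _ → refl))
             (trans (+-identityʳ _) (+-identityʳ _)))
𝟙-eqL-++ (a ∷ L) R [] = refl
𝟙-eqL-++ (a ∷ L) R (x ∷ w) = begin
  𝟙 ((a == x) ∧ eqL (L ++ R) w)
    ≡⟨ 𝟙-∧ (a == x) _ ⟩
  𝟙 (a == x) * 𝟙 (eqL (L ++ R) w)
    ≡⟨ cong (𝟙 (a == x) *_) (𝟙-eqL-++ L R w) ⟩
  𝟙 (a == x) * (𝟙 (eqL L []) * g w + splitSum (λ s → 𝟙 (eqL L s)) g w)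
    ≡⟨ *-distribˡ-+ (𝟙 (a == x)) _ _ ⟩
  𝟙 (a == x) * (𝟙 (eqL L []) * g w) + 𝟙 (a == x) * splitSum (λ s → 𝟙 (eqL L s)) g w
    ≡⟨ cong₂ _+_ (*-assoc (𝟙 (a == x)) _ (g w)) (splitSum-*ˡ (𝟙 (a == x)) (λ s → 𝟙 (eqL L s)) g w) ⟨
  𝟙 (a == x) * 𝟙 (eqL L []) * g w + splitSum (λ s → 𝟙 (a == x) * 𝟙 (eqL L s)) g w
    ≡⟨ cong₂ _+_ (cong (_* g w) (𝟙-∧ (a == x) (eqL L [])))
                 (splitSum-cong w (λ s → 𝟙-∧ (a == x) (eqL L s)) (λ _ → refl)) ⟨
  𝟙 ((a == x) ∧ eqL L []) * g w + splitSum (λ s → 𝟙 ((a == x) ∧ eqL L s)) g w ∎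
  where
  open ≡-Reasoning
  g : List Bool → ℕ
  g t = 𝟙 (eqL R t)

labels-≢[] : ∀ b T → eqL (labels b T) [] ≡ false
labels-≢[] b leaf = refl
labels-≢[] b (node l r) = nonempty-++ (labels ● l) (labels-≢[] ● l)
  where
  nonempty-++ : ∀ xs {ys} → eqL xs [] ≡ false → eqL (xs ++ ys) [] ≡ false
  nonempty-++ (_ ∷ _) _ = refl

sum-splitSumˡ : ∀ {A : Set} (xs : List A) (φ : A → List Bool → ℕ) g w →
  sum (map (λ x → splitSum (φ x) g w) xs) ≡ splitSum (λ s → sum (map (λ x → φ x s) xs)) g w
sum-splitSumˡ [] φ g w = sym (splitSum-zeroˡ g w λ _ → refl)
sum-splitSumˡ (x ∷ xs) φ g w =
  trans (cong (splitSum (φ x) g w +_) (sum-splitSumˡ xs φ g w)) (sym (splitSum-+ˡ (φ x) _ g w))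

sum-splitSumʳ : ∀ {A : Set} (xs : List A) f (ψ : A → List Bool → ℕ) w →
  sum (map (λ x → splitSum f (ψ x) w) xs) ≡ splitSum f (λ t → sum (map (λ x → ψ x t) xs)) w
sum-splitSumʳ [] f ψ w = sym (splitSum-zeroʳ f w λ _ → refl)
sum-splitSumʳ (x ∷ xs) f ψ w =
  trans (cong (splitSum f (ψ x) w +_) (sum-splitSumʳ xs f ψ w)) (sym (splitSum-+ʳ f (ψ x) _ w))

treeCount-labels : ∀ d b w → sum (map (λ T → 𝟙 (eqL (labels b T) w)) (treesUpTo d)) ≡ treeCount d b w
treeCount-labels zero b w = trans (+-identityʳ _) (𝟙-eqL-[ b ] w)
treeCount-labels (suc d) b w = cong₂ _+_ (𝟙-eqL-[ b ] w) (begin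
  sum (map h (concatMap (λ l → map (node l) Ts) Ts))
    ≡⟨ sum-map-concatMap h (λ l → map (node l) Ts) Ts ⟩
  sum (map (λ l → sum (map h (map (node l) Ts))) Ts)
    ≡⟨ cong sum (map-cong (λ l → cong sum (sym (map-∘ Ts))) Ts) ⟩
  sum (map (λ l → sum (map (λ r → 𝟙 (eqL (labels ● l ++ labels ○ r) w)) Ts)) Ts)
    ≡⟨ cong sum (map-cong (λ l → cong sum (map-cong (node-splitSum l) Ts)) Ts) ⟩
  sum (map (λ l → sum (map (λ r → splitSum (count ● l) (count ○ r) w) Ts)) Ts)
    ≡⟨ cong sum (map-cong (λ l → sum-splitSumʳ Ts (count ● l) (count ○) w) Ts) ⟩
  sum (map (λ l → splitSum (count ● l) (λ t → sum (map (λ r → count ○ r t) Ts)) w) Ts)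
    ≡⟨ sum-splitSumˡ Ts (count ●) _ w ⟩
  splitSum (λ s → sum (map (λ l → count ● l s) Ts)) (λ t → sum (map (λ r → count ○ r t) Ts)) w
    ≡⟨ splitSum-cong w (treeCount-labels d ●) (treeCount-labels d ○) ⟩
  splitSum (treeCount d ●) (treeCount d ○) w ∎)
  where
  open ≡-Reasoning
  Ts = treesUpTo d
  h : Tree → ℕ
  h T = 𝟙 (eqL (labels b T) w)
  count : Bool → Tree → List Bool → ℕ
  count b' T s = 𝟙 (eqL (labels b' T) s)
  node-splitSum : ∀ l r → 𝟙 (eqL (labels ● l ++ labels ○ r) w) ≡ splitSum (count ● l) (count ○ r) w
  node-splitSum l r = trans (𝟙-eqL-++ (labels ● l) (labels ○ r) w)
                            (cong (λ e → 𝟙 e * count ○ r w + splitSum (count ● l) (count ○ r) w) (labels-≢[] ● l))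

length-filter-filter : ∀ {A : Set} {p q} {P : Pred A p} {Q : Pred A q} (P? : Decidable P) (Q? : Decidable Q) xs →
  length (filter P? (filter Q? xs)) ≡ sum (map (λ x → 𝟙 (does (Q? x)) * 𝟙 (does (P? x))) xs)
length-filter-filter P? Q? [] = refl
length-filter-filter P? Q? (x ∷ xs) with does (Q? x)
... | false = length-filter-filter P? Q? xs
... | true with does (P? x)
...   | true = cong suc (length-filter-filter P? Q? xs)
...   | false = length-filter-filter P? Q? xs

𝟙-does-× : ∀ {A B : Set} (A? : Dec A) (B? : Dec B) e → (A → B → e ≡ true) → (e ≡ true → A × B) →
  𝟙 (does A?) * 𝟙 (does B?) ≡ 𝟙 e
𝟙-does-× (yes a) (yes b) e ⇐ _ rewrite ⇐ a b = refl
𝟙-does-× (yes a) (no ¬b) true _ ⇒ = ⊥-elim (¬b (proj₂ (⇒ refl)))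
𝟙-does-× (yes a) (no ¬b) false _ _ = refl
𝟙-does-× (no ¬a) B? true _ ⇒ = ⊥-elim (¬a (proj₁ (⇒ refl)))
𝟙-does-× (no ¬a) B? false _ _ = refl

framed : List Bool → List Bool
framed c = ● ∷ c ++ [ ○ ]

length-framed : ∀ c → length (framed c) ≡ length c + 2
length-framed c = trans (cong suc (length-++ c)) (sym (+-suc (length c) 1))

framed-∷ : ∀ u x v → framed (u ++ x ∷ v) ≡ (● ∷ u) ++ x ∷ (v ++ [ ○ ])
framed-∷ u x v = cong (● ∷_) (++-assoc u (x ∷ v) [ ○ ])

take-length-++ : ∀ {A : Set} (c : List A) ys → take (length c) (c ++ ys) ≡ c
take-length-++ [] ys = refl
take-length-++ (x ∷ c) ys = cong (x ∷_) (take-length-++ c ys)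

length-labels : ∀ b T → length (labels b T) ≡ leaves T
length-labels b leaf = refl
length-labels b (node l r) = trans (length-++ (labels ● l)) (cong₂ _+_ (length-labels ● l) (length-labels ○ r))

labels-node : ∀ l r → Σ[ c ∈ List Bool ] labels ○ (node l r) ≡ framed c
labels-node l r with first-● l | last-○ r
  where
  first-● : ∀ T → Σ[ xs ∈ List Bool ] labels ● T ≡ ● ∷ xs
  first-● leaf = [] , refl
  first-● (node l r) with first-● l
  ... | xs , eq rewrite eq = xs ++ labels ○ r , refl
  last-○ : ∀ T → Σ[ ys ∈ List Bool ] labels ○ T ≡ ys ++ [ ○ ]
  last-○ leaf = [] , refl
  last-○ (node l r) with last-○ r
  ... | ys , eq rewrite eq = labels ● l ++ ys , sym (++-assoc (labels ● l) ys [ ○ ])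
... | xs , eq● | ys , eq○ rewrite eq● | eq○ = xs ++ ys , cong (● ∷_) (sym (++-assoc xs ys [ ○ ]))

R-framed : ∀ T c → labels ○ T ≡ framed c → R (length c) T ≡ c
R-framed T c eq = trans (cong (take (length c) ∘ drop 1) eq) (take-length-++ c [ ○ ])

in-fibre⇔framed : ∀ n T c → length c ≡ n → (leaves T ≡ n + 2 × R n T ≡ c → labels ○ T ≡ framed c)
                                         × (labels ○ T ≡ framed c → leaves T ≡ n + 2 × R n T ≡ c)
in-fibre⇔framed n T c refl = forth T , back
  where
  back : labels ○ T ≡ framed c → leaves T ≡ length c + 2 × R (length c) T ≡ c
  back eq = trans (sym (length-labels ○ T)) (trans (cong length eq) (length-framed c)) , R-framed T c eq
  forth : ∀ T → leaves T ≡ length c + 2 × R (length c) T ≡ c → labels ○ T ≡ framed c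
  forth leaf (one≡ , _) with trans one≡ (+-comm (length c) 2)
  ... | ()
  forth (node l r) (leaves≡ , R≡c) with labels-node l r
  ... | M , eq = trans eq (cong framed M≡c)
    where
    |M|≡|c| : length M ≡ length c
    |M|≡|c| = +-cancelʳ-≡ 2 _ _ (trans (sym (length-framed M)) (trans (cong length (sym eq))
                                   (trans (length-labels ○ (node l r)) leaves≡)))
    M≡c : M ≡ c
    M≡c = trans (sym (R-framed (node l r) M eq)) (trans (cong (λ k → R k (node l r)) |M|≡|c|) R≡c)

weight : ℕ → List Bool → ℕ
weight n c = treeCount (n + 2) ○ (framed c)

fibre≡weight : ∀ n (C : Config n) → fibre n C ≡ weight n (toList C)
fibre≡weight n C = begin
  length (filter (λ T → R n T ≟L c) (filter (λ T → leaves T ≟ n + 2) (treesUpTo (n + 2))))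
    ≡⟨ length-filter-filter (λ T → R n T ≟L c) (λ T → leaves T ≟ n + 2) (treesUpTo (n + 2)) ⟩
  sum (map (λ T → 𝟙 (does (leaves T ≟ n + 2)) * 𝟙 (does (R n T ≟L c))) (treesUpTo (n + 2)))
    ≡⟨ cong sum (map-cong in-fibre (treesUpTo (n + 2))) ⟩
  sum (map (λ T → 𝟙 (eqL (labels ○ T) (framed c))) (treesUpTo (n + 2)))
    ≡⟨ treeCount-labels (n + 2) ○ (framed c) ⟩
  weight n c ∎
  where
  open ≡-Reasoning
  c = toList C
  in-fibre : ∀ T → 𝟙 (does (leaves T ≟ n + 2)) * 𝟙 (does (R n T ≟L c)) ≡ 𝟙 (eqL (labels ○ T) (framed c))
  in-fibre T with in-fibre⇔framed n T c (length-toList C)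
  ... | ⇒ , ⇐ = 𝟙-does-× (leaves T ≟ n + 2) (R n T ≟L c) _
    (λ leaves≡ R≡c → trans (cong (λ w → eqL w (framed c)) (⇒ (leaves≡ , R≡c))) (eqL-refl (framed c)))
    (⇐ ∘ eqL-true (labels ○ T) (framed c))

framed-< : ∀ n c → length c < suc n → length (framed c) < suc (n + 2)
framed-< n c lt = subst₂ _<_ (sym (length-framed c)) refl (+-monoˡ-< 2 lt)

framed-∷-< : ∀ n u x v → length (u ++ x ∷ v) < suc n → length ((● ∷ u) ++ x ∷ (v ++ [ ○ ])) < suc (n + 2)
framed-∷-< n u x v lt = subst (λ w → length w < suc (n + 2)) (framed-∷ u x v) (framed-< n (u ++ x ∷ v) lt)

weight-bulk : ∀ n → BulkRelation (suc n) (weight n)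
weight-bulk n u v lt = begin
  G (framed (u ++ ● ∷ ○ ∷ v))
    ≡⟨ cong G (framed-∷ u ● (○ ∷ v)) ⟩
  G ((● ∷ u) ++ ● ∷ ○ ∷ v ++ [ ○ ])
    ≡⟨ treeCount-bulk (n + 2) ○ (● ∷ u) (v ++ [ ○ ]) (framed-∷-< n u ● (○ ∷ v) lt) ⟩
  G ((● ∷ u) ++ ● ∷ v ++ [ ○ ]) + G ((● ∷ u) ++ ○ ∷ v ++ [ ○ ])
    ≡⟨ cong₂ _+_ (cong G (framed-∷ u ● v)) (cong G (framed-∷ u ○ v)) ⟨
  G (framed (u ++ ● ∷ v)) + G (framed (u ++ ○ ∷ v)) ∎
  where
  open ≡-Reasoning
  G = treeCount (n + 2) ○

weight-right : ∀ n → RightRelation (suc n) (weight n)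
weight-right n u lt = begin
  G (framed (u ++ [ ● ]))                  ≡⟨ cong G (framed-∷ u ● []) ⟩
  G ((● ∷ u) ++ ● ∷ ○ ∷ [])                ≡⟨ treeCount-bulk (n + 2) ○ (● ∷ u) [] (framed-∷-< n u ● [] lt) ⟩
  G (● ∷ u ++ [ ● ]) + weight n u          ≡⟨ cong (_+ weight n u) (treeCount-∷● (n + 2) ○ ● u) ⟩
  weight n u                               ∎
  where
  open ≡-Reasoning
  G = treeCount (n + 2) ○

weight-left : ∀ n v → length (○ ∷ v) < suc n → weight n (○ ∷ v) ≡ weight n v
weight-left n v lt =
  trans (treeCount-bulk (n + 2) ○ [] (v ++ [ ○ ]) (framed-< n (○ ∷ v) lt))
        (trans (cong (weight n v +_) (no-tree v)) (+-identityʳ _))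
  where
  no-tree : ∀ v → treeCount (n + 2) ○ (○ ∷ v ++ [ ○ ]) ≡ 0
  no-tree [] = treeCount-○∷ (n + 2) ○ ○ []
  no-tree (c ∷ v) = treeCount-○∷ (n + 2) ○ c (v ++ [ ○ ])

proposition2 : (m : ℕ) → let n = suc m in (C : Config n) →
    fibre n C * Σc n (λ C' → W C C') ≡ Σc n (λ C' → fibre n C' * W C' C)
proposition2 m (x ∷ C₀) = begin
  fibre n C * Σc n (λ C' → W C C')
    ≡⟨ cong₂ _*_ (fibre≡weight n C) (Σc-W-outgoing n C) ⟩
  weight n c * (entryRate c + (exitRate c + hopRate c))
    ≡⟨ stationary (suc n) (weight n) x c₀ (s≤s (≤-reflexive (length-toList C)))
                  (weight-bulk n) (weight-right n) (weight-left n c₀ (s≤s (≤-reflexive (length-toList C)))) ⟩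
  entryInflux (weight n) c + (exitInflux (weight n) c + hopInflux (weight n) c)
    ≡⟨ Σc-W-incoming n (weight n) C ⟨
  Σc n (λ C' → weight n (toList C') * W C' C)
    ≡⟨ Σc-cong n (λ C' → cong (_* W C' C) (fibre≡weight n C')) ⟨
  Σc n (λ C' → fibre n C' * W C' C) ∎
  where
  open ≡-Reasoning
  n = suc m
  C = x ∷ C₀
  c = toList C
  c₀ = toList C₀
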